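{- Let $M$ be a finite matroid which is 3-flat. Then $M$ is pseudomodular.
   Context: Let $M$ be a matroid on ground set $N$ with rank function $r$, and let $\mathcal{F}$ be its set of flats (sets $F$ with $r(F\cup\{n\})>r(F)$ for all $n\notin F$). For a finite collection (multiset) of flats $\mathcal{C} = \{F_i : i \in I\}$, put $F_S = \bigcap_{i\in S} F_i$ for $\emptyset \neq S \subseteq I$ and $F_\emptyset = \bigcup_{i\in I} F_i$, and define $\Delta(\mathcal{C}) = \sum_{S \subseteq I} (-1)^{|S|} r(F_S)$. $M$ is called $n$-flat if $\Delta(\mathcal{C}) \leq 0$ for every such collection $\mathcal{C}$ of flats with $|\mathcal{C}| \leq n$. For flats $A,B$, write $r(A/B) := r(A\cup B)-r(B)$; a flat $B_0$ is the pseudointersection of $A$ and $B$ if for every flat $B_1\subseteq B$, $r(A/B_1)=r(A/B)$ holds if and only if $B_0\subseteq B_1$. $M$ is pseudomodular if for all flats $A,B$ the pseudointersection of $A$ and $B$ exists. -}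

module Defs where

open import Data.Nat as ℕ using (ℕ; zero; suc; _≤_; _<_; _∸_)
open import Data.Integer as ℤ using (ℤ; +_; -_)
open import Data.Fin using (Fin; zero; suc)
open import Data.Fin.Subset using (Subset; _⊆_; _∉_; _∪_; _∩_; ⊤; ⊥; ⁅_⁆; ∣_∣)
open import Data.Vec using (_∷_; [])
open import Data.Bool using (true; false)
open import Data.Product using (_×_; ∃)
open import Function using (_∘_)

record Matroid (n : ℕ) : Set where
  field
    r      : Subset n → ℕ
    r-bound : ∀ X → r X ≤ ∣ X ∣
    r-mono  : ∀ {X Y} → X ⊆ Y → r X ≤ r Y
    r-submod : ∀ X Y → r (X ∪ Y) ℕ.+ r (X ∩ Y) ≤ r X ℕ.+ r Y

module _ {n : ℕ} (M : Matroid n) where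
  open Matroid M

  IsFlat : Subset n → Set
  IsFlat F = ∀ x → x ∉ F → r F < r (F ∪ ⁅ x ⁆)

  relRank : Subset n → Subset n → ℕ
  relRank A B = r (A ∪ B) ∸ r B

  IsPseudointersection : Subset n → Subset n → Subset n → Set
  IsPseudointersection A B B0 =
    IsFlat B0 ×
    (∀ B1 → IsFlat B1 → B1 ⊆ B →
      (relRank A B1 ≡ℕ relRank A B → B0 ⊆ B1) × (B0 ⊆ B1 → relRank A B1 ≡ℕ relRank A B))
    where open import Relation.Binary.PropositionalEquality renaming (_≡_ to _≡ℕ_)

  IsPseudomodular : Set
  IsPseudomodular = ∀ A B → IsFlat A → IsFlat B → ∃ λ B0 → IsPseudointersection A B B0

⋂sel : ∀ {n} k → (Fin k → Subset n) → Subset k → Subset n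
⋂sel zero    C []          = ⊤
⋂sel (suc k) C (true ∷ S)  = C zero ∩ ⋂sel k (C ∘ suc) S
⋂sel (suc k) C (false ∷ S) = ⋂sel k (C ∘ suc) S

⋃all : ∀ {n} k → (Fin k → Subset n) → Subset n
⋃all zero    C = ⊥
⋃all (suc k) C = C zero ∪ ⋃all k (C ∘ suc)

F[_] : ∀ {n} k → (Fin k → Subset n) → Subset k → Subset n
F[ k ] C S with ∣ S ∣
... | zero  = ⋃all k C
... | suc _ = ⋂sel k C S

sgn : ℕ → ℤ
sgn zero    = + 1
sgn (suc m) = - sgn m

ΣSubsets : ∀ k → (Subset k → ℤ) → ℤ
ΣSubsets zero    f = f []
ΣSubsets (suc k) f = ΣSubsets k (λ S → f (false ∷ S)) ℤ.+ ΣSubsets k (λ S → f (true ∷ S))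

module _ {n : ℕ} (M : Matroid n) where
  open Matroid M

  Δ : ∀ k → (Fin k → Subset n) → ℤ
  Δ k C = ΣSubsets k (λ S → sgn ∣ S ∣ ℤ.* + r (F[ k ] C S))

  IsNFlat : ℕ → Set
  IsNFlat m = ∀ k → k ≤ m → (C : Fin k → Subset n) → (∀ i → IsFlat M (C i)) → Δ k C ℤ.≤ + 0

-- Fix flats A and B and call a flat S ⊆ B preserving if r(A/S) = r(A/B).
-- B is preserving, and 3-flatness of the three flats cl(A ∪ S₁), cl(A ∪ S₂)
-- and B shows that preserving flats are closed under intersection: the
-- closures meet B exactly in S₁ and S₂, so the 3-flat inequality collapses
-- to r(A/S₁ ∩ S₂) ≤ r(A/B).  Hence the intersection B₀ of all preserving flats
-- is preserving, and since r(A/−) is antitone every flat between B₀ and B is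
-- preserving too: B₀ is the pseudointersection of A and B.
module Submission where

open import Defs
open import Data.Nat using (ℕ)

open import Data.Nat using (_+_; _≤_; _<_; _∸_; _≤?_; _<?_; _≟_)
open import Data.Nat.Properties
  using ( ≤-refl; ≤-trans; ≤-antisym; <⇒≱; ≰⇒>; +-comm; +-mono-≤; +-monoˡ-≤
        ; +-monoˡ-<; +-cancelˡ-≤; +-cancelʳ-≤; +-cancelˡ-<; m∸n+n≡m; [m+n]∸[m+o]≡n∸o
        ; +-commutativeSemigroup; module ≤-Reasoning)
open import Algebra.Properties.CommutativeSemigroup +-commutativeSemigroup using (xy∙z≈xz∙y)
open import Data.Nat.Tactic.RingSolver as ℕ-Solver using ()
open import Data.Integer as ℤ using (+_; 0ℤ; 1ℤ; -1ℤ)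
open import Data.Integer.Properties using (i-j≤0⇒i≤j; drop‿+≤+; pos-+)
open import Data.Integer.Tactic.RingSolver as ℤ-Solver using ()
open import Data.Fin using (Fin; zero; suc)
open import Data.Fin.Properties using (any?; all?)
open import Data.Fin.Subset using (Subset; _∈_; _∉_; _⊆_; _⊂_; _⊃_; _∪_; _∩_; ⁅_⁆)
open import Data.Fin.Subset.Properties
  using ( _∈?_; _⊆?_; anySubset?; ⊆-refl; ⊆-trans; p⊆p∪q; q⊆p∪q; p∩q⊆p; p∩q⊆q
        ; x∈p∪q⁻; x∈p∩q⁺; x∈⁅x⁆; x∈⁅y⁆⇒x≡y; ∪-identityʳ; ∩-identityʳ)
open import Data.Fin.Subset.Induction using (Acc; acc; ⊂-wellFounded; ⊃-wellFounded)
open import Data.List using ([]; _∷_)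
open import Data.Product using (_×_; _,_; ∃)
open import Data.Sum using ([_,_])
open import Function using (_∘_)
open import Level using (Level)
open import Relation.Binary.PropositionalEquality
  using (_≡_; refl; sym; trans; cong; cong₂; subst; subst₂; module ≡-Reasoning)
open import Relation.Nullary using (¬_; yes; no)
open import Relation.Nullary.Decidable using (¬?; _×-dec_; _→-dec_; decidable-stable)
open import Relation.Unary using (Pred; Decidable)

private
  variable
    ℓ : Level
    n : ℕ

m∸n≡o∸p⇒m+p≡o+n : ∀ {m n o p} → n ≤ m → p ≤ o → m ∸ n ≡ o ∸ p → m + p ≡ o + n
m∸n≡o∸p⇒m+p≡o+n {m} {n} {o} {p} n≤m p≤o eq = begin
  m + p              ≡⟨ cong (_+ p) (sym (m∸n+n≡m n≤m)) ⟩
  m ∸ n + n + p      ≡⟨ cong (λ k → k + n + p) eq ⟩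
  o ∸ p + n + p      ≡⟨ xy∙z≈xz∙y (o ∸ p) n p ⟩
  o ∸ p + p + n      ≡⟨ cong (_+ n) (m∸n+n≡m p≤o) ⟩
  o + n              ∎
  where open ≡-Reasoning

m+p≡o+n⇒m∸n≡o∸p : ∀ {m n o p} → m + p ≡ o + n → m ∸ n ≡ o ∸ p
m+p≡o+n⇒m∸n≡o∸p {m} {n} {o} {p} eq = begin
  m ∸ n              ≡⟨ sym ([m+n]∸[m+o]≡n∸o p m n) ⟩
  (p + m) ∸ (p + n)  ≡⟨ cong₂ _∸_ (trans (+-comm p m) (trans eq (+-comm o n))) (+-comm p n) ⟩
  (n + o) ∸ (n + p)  ≡⟨ [m+n]∸[m+o]≡n∸o n o p ⟩
  o ∸ p              ∎
  where open ≡-Reasoning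

-- The hypothesis is Δ of three sets exactly as Δ unfolds: each term is
-- sgn |S| ℤ.* + r(F_S), in the order in which ΣSubsets enumerates S.
Δ₃≤0⇒ : ∀ u a b c ab ac bc abc →
  (1ℤ ℤ.* + u ℤ.+ -1ℤ ℤ.* + c) ℤ.+ (-1ℤ ℤ.* + b ℤ.+ 1ℤ ℤ.* + bc) ℤ.+
  ((-1ℤ ℤ.* + a ℤ.+ 1ℤ ℤ.* + ac) ℤ.+ (1ℤ ℤ.* + ab ℤ.+ -1ℤ ℤ.* + abc)) ℤ.≤ 0ℤ →
  u + ab + ac + bc ≤ a + b + c + abc
Δ₃≤0⇒ u a b c ab ac bc abc Δ≤0 =
  drop‿+≤+ (subst₂ ℤ._≤_ (sym (pos-+₄ u ab ac bc)) (sym (pos-+₄ a b c abc))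
    (i-j≤0⇒i≤j (subst (ℤ._≤ 0ℤ) (expand (+ u) (+ a) (+ b) (+ c) (+ ab) (+ ac) (+ bc) (+ abc)) Δ≤0)))
  where
  expand : ∀ u a b c ab ac bc abc →
    (1ℤ ℤ.* u ℤ.+ -1ℤ ℤ.* c) ℤ.+ (-1ℤ ℤ.* b ℤ.+ 1ℤ ℤ.* bc) ℤ.+
    ((-1ℤ ℤ.* a ℤ.+ 1ℤ ℤ.* ac) ℤ.+ (1ℤ ℤ.* ab ℤ.+ -1ℤ ℤ.* abc))
    ≡ (u ℤ.+ ab ℤ.+ ac ℤ.+ bc) ℤ.- (a ℤ.+ b ℤ.+ c ℤ.+ abc)
  expand = ℤ-Solver.solve-∀
  pos-+₄ : ∀ w x y z → + (w + x + y + z) ≡ + w ℤ.+ + x ℤ.+ + y ℤ.+ + z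
  pos-+₄ w x y z =
    trans (pos-+ (w + x + y) z) (cong (ℤ._+ + z) (trans (pos-+ (w + x) y) (cong (ℤ._+ + y) (pos-+ w x))))

∪-lub : {P Q R : Subset n} → P ⊆ R → Q ⊆ R → P ∪ Q ⊆ R
∪-lub {P = P} {Q} P⊆R Q⊆R = [ P⊆R , Q⊆R ] ∘ x∈p∪q⁻ P Q

∩-glb : {P Q R : Subset n} → R ⊆ P → R ⊆ Q → R ⊆ P ∩ Q
∩-glb R⊆P R⊆Q x∈R = x∈p∩q⁺ (R⊆P x∈R , R⊆Q x∈R)

⁅x⁆⊆ : {x : Fin n} {P : Subset n} → x ∈ P → ⁅ x ⁆ ⊆ P
⁅x⁆⊆ {x = x} {P} x∈P y∈⁅x⁆ = subst (_∈ P) (sym (x∈⁅y⁆⇒x≡y x y∈⁅x⁆)) x∈P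

maximal-element : {P : Pred (Subset n) ℓ} → Decidable P → ∀ {X} → P X →
  ∃ λ Z → P Z × (∀ x → x ∉ Z → ¬ P (Z ∪ ⁅ x ⁆))
maximal-element {P = P} P? {X} = go X (⊃-wellFounded X)
  where
  go : ∀ Z → Acc _⊃_ Z → P Z → ∃ λ Z → P Z × (∀ x → x ∉ Z → ¬ P (Z ∪ ⁅ x ⁆))
  go Z (acc rs) PZ with any? (λ x → ¬? (x ∈? Z) ×-dec P? (Z ∪ ⁅ x ⁆))
  ... | yes (x , x∉Z , PZx) = go (Z ∪ ⁅ x ⁆) (rs Z⊂Zx) PZx
    where
    Z⊂Zx : Z ⊂ Z ∪ ⁅ x ⁆
    Z⊂Zx = p⊆p∪q ⁅ x ⁆ , x , q⊆p∪q Z ⁅ x ⁆ (x∈⁅x⁆ x) , x∉Z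
  ... | no ¬grow = Z , PZ , λ x x∉Z PZx → ¬grow (x , x∉Z , PZx)

least-element : {P : Pred (Subset n) ℓ} → Decidable P →
  (∀ {S T} → P S → P T → P (S ∩ T)) → ∀ {X} → P X →
  ∃ λ L → P L × (∀ {S} → P S → L ⊆ S)
least-element {P = P} P? P-∩ {X} = go X (⊂-wellFounded X)
  where
  go : ∀ Z → Acc _⊂_ Z → P Z → ∃ λ L → P L × (∀ {S} → P S → L ⊆ S)
  go Z (acc rs) PZ with anySubset? (λ S → P? S ×-dec any? (λ x → x ∈? Z ×-dec ¬? (x ∈? S)))
  ... | yes (S , PS , x , x∈Z , x∉S) = go (Z ∩ S) (rs Z∩S⊂Z) (P-∩ PZ PS)
    where
    Z∩S⊂Z : Z ∩ S ⊂ Z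
    Z∩S⊂Z = p∩q⊆p Z S , x , x∈Z , x∉S ∘ p∩q⊆q Z S
  ... | no ¬shrink = Z , PZ , λ {S} PS {x} x∈Z →
    decidable-stable (x ∈? S) (λ x∉S → ¬shrink (S , PS , x , x∈Z , x∉S))

module _ (M : Matroid n) where
  open Matroid M

  r-submodular-⊆ : ∀ {U I X Y} → U ⊆ X ∪ Y → I ⊆ X ∩ Y → r U + r I ≤ r X + r Y
  r-submodular-⊆ {X = X} {Y} U⊆ I⊆ = ≤-trans (+-mono-≤ (r-mono U⊆) (r-mono I⊆)) (r-submod X Y)

  -- r(A/Y) ≤ r(A/X), in additive form.
  relRank-antitone : ∀ A {X Y} → X ⊆ Y → r (A ∪ Y) + r X ≤ r (A ∪ X) + r Y
  relRank-antitone A {X} {Y} X⊆Y =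
    r-submodular-⊆ (∪-lub (⊆-trans (p⊆p∪q X) (p⊆p∪q Y)) (q⊆p∪q (A ∪ X) Y))
                   (∩-glb (q⊆p∪q A X) X⊆Y)

  isFlat? : Decidable (IsFlat M)
  isFlat? F = all? (λ x → ¬? (x ∈? F) →-dec r F <? r (F ∪ ⁅ x ⁆))

  isFlat⇒r< : ∀ {F I x} → IsFlat M F → I ⊆ F → x ∉ F → r I < r (I ∪ ⁅ x ⁆)
  isFlat⇒r< {F} {I} {x} flatF I⊆F x∉F = +-cancelˡ-< (r F) _ _ (begin-strict
    r F + r I                <⟨ +-monoˡ-< (r I) (flatF x x∉F) ⟩
    r (F ∪ ⁅ x ⁆) + r I       ≤⟨ r-submodular-⊆ (∪-lub (q⊆p∪q _ F) (⊆-trans (q⊆p∪q I ⁅ x ⁆) (p⊆p∪q F)))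
                                               (∩-glb (p⊆p∪q ⁅ x ⁆) I⊆F) ⟩
    r (I ∪ ⁅ x ⁆) + r F       ≡⟨ +-comm (r (I ∪ ⁅ x ⁆)) (r F) ⟩
    r F + r (I ∪ ⁅ x ⁆)       ∎)
    where open ≤-Reasoning

  isFlat-∩ : ∀ {F G} → IsFlat M F → IsFlat M G → IsFlat M (F ∩ G)
  isFlat-∩ {F} {G} flatF flatG x x∉F∩G with x ∈? F
  ... | no x∉F = isFlat⇒r< flatF (p∩q⊆p F G) x∉F
  ... | yes x∈F = isFlat⇒r< flatG (p∩q⊆q F G) (λ x∈G → x∉F∩G (x∈p∩q⁺ (x∈F , x∈G)))

  isFlat⇒⊇ : ∀ {F X} → IsFlat M F → F ⊆ X → r X ≤ r F → X ⊆ F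
  isFlat⇒⊇ {F} flatF F⊆X rX≤rF {x} x∈X = decidable-stable (x ∈? F) λ x∉F →
    <⇒≱ (flatF x x∉F) (≤-trans (r-mono (∪-lub F⊆X (⁅x⁆⊆ x∈X))) rX≤rF)

  -- A maximal superset of Y of rank r Y is flat: it is the closure of Y.
  flat-hull : ∀ Y → ∃ λ G → Y ⊆ G × r G ≤ r Y × IsFlat M G
  flat-hull Y with maximal-element (λ Z → Y ⊆? Z ×-dec r Z ≤? r Y) (⊆-refl , ≤-refl)
  ... | G , (Y⊆G , rG≤rY) , maximal = G , Y⊆G , rG≤rY , λ x x∉G → ≰⇒> λ rGx≤rG →
    maximal x x∉G (⊆-trans Y⊆G (p⊆p∪q ⁅ x ⁆) , ≤-trans rGx≤rG rG≤rY)

  IsNFlat⇒three-flat : IsNFlat M 3 → ∀ {F G H} → IsFlat M F → IsFlat M G → IsFlat M H →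
    r (F ∪ G ∪ H) + r (F ∩ G) + r (F ∩ H) + r (G ∩ H) ≤ r F + r G + r H + r (F ∩ G ∩ H)
  IsNFlat⇒three-flat 3-flat {F} {G} {H} flatF flatG flatH
    with Δ≤0 ← 3-flat 3 ≤-refl (λ { zero → F ; (suc zero) → G ; (suc (suc zero)) → H })
                              (λ { zero → flatF ; (suc zero) → flatG ; (suc (suc zero)) → flatH })
    rewrite ∪-identityʳ H | ∩-identityʳ F | ∩-identityʳ G | ∩-identityʳ H
    = Δ₃≤0⇒ (r (F ∪ G ∪ H)) (r F) (r G) (r H) (r (F ∩ G)) (r (F ∩ H)) (r (G ∩ H)) (r (F ∩ G ∩ H)) Δ≤0

  module _ (A B : Subset n) where

    -- r(A/S) = r(A/B), stated without truncated subtraction.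
    Preserving : Subset n → Set
    Preserving S = IsFlat M S × S ⊆ B × r (A ∪ S) + r B ≡ r (A ∪ B) + r S

    preserving? : Decidable Preserving
    preserving? S = isFlat? S ×-dec S ⊆? B ×-dec r (A ∪ S) + r B ≟ r (A ∪ B) + r S

    relRank≡⇒ : ∀ S → relRank M A S ≡ relRank M A B → r (A ∪ S) + r B ≡ r (A ∪ B) + r S
    relRank≡⇒ S = m∸n≡o∸p⇒m+p≡o+n (r-mono (q⊆p∪q A S)) (r-mono (q⊆p∪q A B))

    ⇒relRank≡ : ∀ S → r (A ∪ S) + r B ≡ r (A ∪ B) + r S → relRank M A S ≡ relRank M A B
    ⇒relRank≡ S = m+p≡o+n⇒m∸n≡o∸p {r (A ∪ S)} {r S} {r (A ∪ B)} {r B}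

    preserving-⊇ : ∀ {B₀ B₁} → Preserving B₀ → B₀ ⊆ B₁ → B₁ ⊆ B →
      r (A ∪ B₁) + r B ≡ r (A ∪ B) + r B₁
    preserving-⊇ {B₀} {B₁} (_ , _ , eq₀) B₀⊆B₁ B₁⊆B =
      ≤-antisym (+-cancelʳ-≤ (r B₀) _ _ (begin
        r (A ∪ B₁) + r B + r B₀    ≡⟨ xy∙z≈xz∙y (r (A ∪ B₁)) (r B) (r B₀) ⟩
        r (A ∪ B₁) + r B₀ + r B    ≤⟨ +-monoˡ-≤ (r B) (relRank-antitone A B₀⊆B₁) ⟩
        r (A ∪ B₀) + r B₁ + r B    ≡⟨ xy∙z≈xz∙y (r (A ∪ B₀)) (r B₁) (r B) ⟩
        r (A ∪ B₀) + r B + r B₁    ≡⟨ cong (_+ r B₁) eq₀ ⟩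
        r (A ∪ B) + r B₀ + r B₁    ≡⟨ xy∙z≈xz∙y (r (A ∪ B)) (r B₀) (r B₁) ⟩
        r (A ∪ B) + r B₁ + r B₀    ∎))
        (relRank-antitone A B₁⊆B)
      where open ≤-Reasoning

    hull-∩-⊆ : ∀ {S G} → Preserving S → A ∪ S ⊆ G → r G ≤ r (A ∪ S) → G ∩ B ⊆ S
    hull-∩-⊆ {S} {G} (flatS , S⊆B , eq) A∪S⊆G rG≤ =
      isFlat⇒⊇ flatS (∩-glb (A∪S⊆G ∘ q⊆p∪q A S) S⊆B) (+-cancelˡ-≤ (r (A ∪ B)) _ _ (begin
        r (A ∪ B) + r (G ∩ B)    ≤⟨ r-submodular-⊆ (∪-lub (⊆-trans (A∪S⊆G ∘ p⊆p∪q S) (p⊆p∪q B)) (q⊆p∪q G B)) ⊆-refl ⟩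
        r G + r B                ≤⟨ +-monoˡ-≤ (r B) rG≤ ⟩
        r (A ∪ S) + r B          ≡⟨ eq ⟩
        r (A ∪ B) + r S          ∎))
      where open ≤-Reasoning

    relRank-∩-≤ : IsNFlat M 3 → IsFlat M B → ∀ {S₁ S₂} → Preserving S₁ → Preserving S₂ →
      r (A ∪ S₁ ∩ S₂) + r B ≤ r (A ∪ B) + r (S₁ ∩ S₂)
    relRank-∩-≤ 3-flat flatB {S₁} {S₂} p₁@(_ , S₁⊆B , eq₁) p₂@(_ , S₂⊆B , eq₂)
      with flat-hull (A ∪ S₁) | flat-hull (A ∪ S₂)
    ... | G₁ , A∪S₁⊆G₁ , rG₁≤ , flatG₁ | G₂ , A∪S₂⊆G₂ , rG₂≤ , flatG₂ =
      cancel (r (A ∪ B)) (r (A ∪ S₁ ∩ S₂)) (r S₁) (r S₂) (r (A ∪ S₁)) (r (A ∪ S₂)) (r B) (r (S₁ ∩ S₂)) (begin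
        r (A ∪ B) + r (A ∪ S₁ ∩ S₂) + r S₁ + r S₂
          ≤⟨ +-mono-≤ (+-mono-≤ (+-mono-≤ (r-mono A∪B⊆) (r-mono A∪S₁₂⊆)) (r-mono (S⊆G∩B A∪S₁⊆G₁ S₁⊆B)))
                      (r-mono (S⊆G∩B A∪S₂⊆G₂ S₂⊆B)) ⟩
        r (G₁ ∪ G₂ ∪ B) + r (G₁ ∩ G₂) + r (G₁ ∩ B) + r (G₂ ∩ B)
          ≤⟨ IsNFlat⇒three-flat 3-flat flatG₁ flatG₂ flatB ⟩
        r G₁ + r G₂ + r B + r (G₁ ∩ G₂ ∩ B)
          ≤⟨ +-mono-≤ (+-monoˡ-≤ (r B) (+-mono-≤ rG₁≤ rG₂≤)) (r-mono G₁₂B⊆) ⟩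
        r (A ∪ S₁) + r (A ∪ S₂) + r B + r (S₁ ∩ S₂) ∎) eq₁ eq₂
      where
      open ≤-Reasoning
      A⊆G₁ : A ⊆ G₁
      A⊆G₁ = A∪S₁⊆G₁ ∘ p⊆p∪q S₁
      A∪B⊆ : A ∪ B ⊆ G₁ ∪ G₂ ∪ B
      A∪B⊆ = ∪-lub (p⊆p∪q (G₂ ∪ B) ∘ A⊆G₁) (q⊆p∪q G₁ (G₂ ∪ B) ∘ q⊆p∪q G₂ B)
      A∪S₁₂⊆ : A ∪ S₁ ∩ S₂ ⊆ G₁ ∩ G₂
      A∪S₁₂⊆ = ∩-glb (∪-lub A⊆G₁ (A∪S₁⊆G₁ ∘ q⊆p∪q A S₁ ∘ p∩q⊆p S₁ S₂))
                     (A∪S₂⊆G₂ ∘ ∪-lub (p⊆p∪q S₂) (q⊆p∪q A S₂ ∘ p∩q⊆q S₁ S₂))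
      S⊆G∩B : ∀ {S G} → A ∪ S ⊆ G → S ⊆ B → S ⊆ G ∩ B
      S⊆G∩B {S} A∪S⊆G S⊆B = ∩-glb (A∪S⊆G ∘ q⊆p∪q A S) S⊆B
      G₁₂B⊆ : G₁ ∩ G₂ ∩ B ⊆ S₁ ∩ S₂
      G₁₂B⊆ = ∩-glb (hull-∩-⊆ p₁ A∪S₁⊆G₁ rG₁≤ ∘ ∩-glb (p∩q⊆p G₁ _) (p∩q⊆q G₂ B ∘ p∩q⊆q G₁ _))
                    (hull-∩-⊆ p₂ A∪S₂⊆G₂ rG₂≤ ∘ p∩q⊆q G₁ _)
      cancel : ∀ u x b₁ b₂ a₁ a₂ b b₁₂ → u + x + b₁ + b₂ ≤ a₁ + a₂ + b + b₁₂ →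
        a₁ + b ≡ u + b₁ → a₂ + b ≡ u + b₂ → x + b ≤ u + b₁₂
      cancel u x b₁ b₂ a₁ a₂ b b₁₂ ineq e₁ e₂ = +-cancelˡ-≤ (u + b₁ + b₂) _ _ (begin
        u + b₁ + b₂ + (x + b)        ≡⟨ ℕ-Solver.solve (u ∷ b₁ ∷ b₂ ∷ x ∷ b ∷ []) ⟩
        u + x + b₁ + b₂ + b          ≤⟨ +-monoˡ-≤ b ineq ⟩
        a₁ + a₂ + b + b₁₂ + b        ≡⟨ ℕ-Solver.solve (a₁ ∷ a₂ ∷ b ∷ b₁₂ ∷ []) ⟩
        (a₁ + b) + (a₂ + b) + b₁₂    ≡⟨ cong₂ (λ p q → p + q + b₁₂) e₁ e₂ ⟩
        (u + b₁) + (u + b₂) + b₁₂    ≡⟨ ℕ-Solver.solve (u ∷ b₁ ∷ b₂ ∷ b₁₂ ∷ []) ⟩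
        u + b₁ + b₂ + (u + b₁₂)      ∎)

    preserving-∩ : IsNFlat M 3 → IsFlat M B → ∀ {S₁ S₂} → Preserving S₁ → Preserving S₂ →
      Preserving (S₁ ∩ S₂)
    preserving-∩ 3-flat flatB {S₁} {S₂} p₁@(flat₁ , S₁⊆B , _) p₂@(flat₂ , _ , _) =
      isFlat-∩ flat₁ flat₂ , S₁∩S₂⊆B ,
      ≤-antisym (relRank-∩-≤ 3-flat flatB p₁ p₂) (relRank-antitone A S₁∩S₂⊆B)
      where
      S₁∩S₂⊆B : S₁ ∩ S₂ ⊆ B
      S₁∩S₂⊆B = S₁⊆B ∘ p∩q⊆p S₁ S₂

theorem2 : ∀ {n : ℕ} (M : Matroid n) → IsNFlat M 3 → IsPseudomodular M
theorem2 M 3-flat A B _ flatB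
  with least-element (preserving? M A B) (preserving-∩ M A B 3-flat flatB) (flatB , ⊆-refl , refl)
... | B₀ , p₀@(flat₀ , _) , least = B₀ , flat₀ , λ B₁ flat₁ B₁⊆B →
  (λ rel≡ → least (flat₁ , B₁⊆B , relRank≡⇒ M A B B₁ rel≡)) ,
  (λ B₀⊆B₁ → ⇒relRank≡ M A B B₁ (preserving-⊇ M A B p₀ B₀⊆B₁ B₁⊆B))
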